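{- Let $m,n\ge 1$ and let $1\le i\le n-m$. Then the number of parking completions of $\mathbf{t}=(i+1,i+2,\dots,i+m)$ in $[n]$ is \[ \big|\mathrm{PC}_n((i+1,\ldots,i+m))\big|=\sum_{k=i}^{n-m}\binom{n-m}{k}(k+1)^{k-1}\,m\,(n-k)^{n-k-m-1}. \]
   Context: For a strictly increasing sequence $\mathbf{t}=(t_1,\dots,t_m)$ of elements of $[n]=\{1,\dots,n\}$, let $\mathbf{u}=(u_1,\dots,u_{n-m})$ be the elements of $[n]\setminus\{t_1,\dots,t_m\}$ in strictly increasing order. A parking completion of $\mathbf{t}$ in $[n]$ is a sequence $\mathbf{c}\in[n]^{n-m}$ whose weakly increasing rearrangement $(c_1,\dots,c_{n-m})$ satisfies $c_j\le u_j$ for all $j$; $\mathrm{PC}_n(\mathbf{t})$ denotes the set of all of them. -}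

module Defs where

open import Data.Nat using (ℕ; zero; suc; _+_; _*_; _∸_; _^_; _≤_; _≤?_; _<_)
open import Data.Nat.Properties using (≤-decTotalOrder)
open import Data.Nat.Combinatorics using (_C_)
open import Data.List using (List; []; _∷_; map; concatMap; filter; length; applyUpTo)
open import Data.Nat.ListAction using (sum)
open import Data.List.Membership.DecPropositional Data.Nat._≟_ using (_∈?_)
open import Data.List.Relation.Binary.Pointwise using (Pointwise)
open import Data.List.Relation.Binary.Pointwise.Properties using (decidable)
open import Relation.Nullary using (Dec; ¬?)
import Data.List.Sort

open Data.List.Sort ≤-decTotalOrder using (sort)

[_] : ℕ → List ℕ
[ n ] = applyUpTo suc n

complement : ℕ → List ℕ → List ℕ
complement n t = filter (λ x → ¬? (x ∈? t)) [ n ]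

seqs : ℕ → ℕ → List (List ℕ)
seqs n zero    = [] ∷ []
seqs n (suc k) = concatMap (λ x → map (x ∷_) (seqs n k)) [ n ]

IsParkingCompletion : ℕ → List ℕ → List ℕ → Set
IsParkingCompletion n t c = Pointwise _≤_ (sort c) (complement n t)

isParkingCompletion? : ∀ n t c → Dec (IsParkingCompletion n t c)
isParkingCompletion? n t c = decidable _≤?_ (sort c) (complement n t)

PC : ℕ → List ℕ → List (List ℕ)
PC n t = filter (isParkingCompletion? n t) (seqs n (n ∸ length t))

#PC : ℕ → List ℕ → ℕ
#PC n t = length (PC n t)

block : ℕ → ℕ → List ℕ
block i m = applyUpTo (λ j → i + suc j) m

sumFromTo : ℕ → ℕ → (ℕ → ℕ) → ℕ
sumFromTo a b f = sum (applyUpTo (λ j → f (a + j)) (suc b ∸ a))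

-- m * (n-k)^(n-k-m-1), read as the rational number it denotes.
-- For k ≤ n-m-1 the exponent is ≥ 0; for k = n-m the exponent is -1 and
-- n-k = m, so the value is m * m^(-1) = 1.
mFactor : ℕ → ℕ → ℕ → ℕ
mFactor m n k with suc (k + m) ≤? n
... | Relation.Nullary.yes _ = m * (n ∸ k) ^ (n ∸ k ∸ m ∸ 1)
... | Relation.Nullary.no  _ = 1

term : ℕ → ℕ → ℕ → ℕ
term m n k = ((n ∸ m) C k) * (suc k ^ (k ∸ 1)) * mFactor m n k

module Submission where

-- With  #≤ x c  the number of entries of c that are ≤ x,
--    a sorted sequence is dominated by the increasing list u iff #≤ u_r c ≥ r+1
--    for every r; here u_r = gap i m r is the r-th element of [n] ∖ t.
-- 3. Breakpoint decomposition.  Every completion c has a unique k ∈ [i, N] with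
--    exactly k entries ≤ k and ≤ k+1; then the entries ≤ k form a parking
--    function of length k, and the entries > k+1, shifted down by k+1, form a
--    "generalized parking sequence" of length N-k with m free spots in front.
-- 4. Splitting.  Summing a product weight f(entries ≤ s)·g(entries > s) over
--    [s+d]^L gives C(L,k) · (sum of f over [s]^k) · (sum of g over [d]^(L-k)).
-- 5. Generalized parking sequences.  The number of c ∈ [n]^L with
--    #≤ (b+j) c ≥ j+1 for all j < L, where b + L = n + 1, is b (b+L)^(L-1);
--    proved by induction, splitting off the entries equal to 1 and closing
--    the recursion with Abel's identity.

open import Defs
open import Data.Nat using (ℕ; zero; suc; _+_; _*_; _∸_; _^_; _≤_; _<_; z≤n; s≤s; s≤s⁻¹; _≤?_; _<?_; _≟_; NonZero)
open import Data.Nat.Properties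
open import Data.Nat.ListAction using (sum)
open import Data.Nat.Combinatorics using (_C_; k>n⇒nCk≡0; nCk+nC[k+1]≡[n+1]C[k+1])
open import Data.Nat.Solver using (module +-*-Solver)
open import Data.List using (List; []; _∷_; length; _++_; map; concat; filter; applyUpTo)
open import Data.List.Properties using (filter-all; filter-none; filter-++; length-applyUpTo)
open import Data.List.Relation.Unary.All as All using (All; []; _∷_)
open import Data.List.Relation.Unary.All.Properties using (applyUpTo⁺₁)
open import Data.List.Relation.Unary.Linked using (Linked; []; [-]; _∷_)
open import Data.List.Relation.Binary.Pointwise using (Pointwise; []; _∷_)
open import Data.List.Relation.Binary.Permutation.Propositional as Perm using (_↭_; prep; swap)
open import Data.List.Relation.Binary.Permutation.Propositional.Properties using (↭-length)
open import Data.List.Membership.Propositional using (_∈_)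
open import Data.List.Membership.Propositional.Properties using (∈-applyUpTo⁺; ∈-applyUpTo⁻)
open import Data.List.Membership.DecPropositional _≟_ using (_∈?_)
import Data.List.Sort
open import Data.Product using (∃; _×_; _,_; proj₁; proj₂)
open import Data.Sum using (_⊎_; inj₁; inj₂)
open import Data.Empty using (⊥-elim)
open import Data.Unit using (⊤; tt)
open import Level using (Level)
open import Relation.Nullary using (Dec; yes; no; ¬_; ¬?)
open import Relation.Unary using (Pred; Decidable)
open import Relation.Binary.Definitions using (tri<; tri≈; tri>)
open import Relation.Binary.PropositionalEquality hiding ([_])

open +-*-Solver
open Data.List.Sort ≤-decTotalOrder using (sort; sort-↭; sort-↗)
open ≡-Reasoning

𝟙 : ∀ {p} {P : Set p} → Dec P → ℕ
𝟙 (yes _) = 1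
𝟙 (no _)  = 0

𝟙-yes : ∀ {p} {P : Set p} (d : Dec P) → P → 𝟙 d ≡ 1
𝟙-yes (yes _) _  = refl
𝟙-yes (no ¬p) p  = ⊥-elim (¬p p)

𝟙-no : ∀ {p} {P : Set p} (d : Dec P) → ¬ P → 𝟙 d ≡ 0
𝟙-no (yes p) ¬p = ⊥-elim (¬p p)
𝟙-no (no _)  _  = refl

𝟙-⇔ : ∀ {p q} {P : Set p} {Q : Set q} (d : Dec P) (e : Dec Q) → (P → Q) → (Q → P) → 𝟙 d ≡ 𝟙 e
𝟙-⇔ (yes p) (yes q) f g = refl
𝟙-⇔ (yes p) (no ¬q) f g = ⊥-elim (¬q (f p))
𝟙-⇔ (no ¬p) (yes q) f g = ⊥-elim (¬p (g q))
𝟙-⇔ (no _)  (no _)  f g = refl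

_reflects_ : ∀ {p} → ℕ → Set p → Set p
w reflects P = (w ≡ 1 × P) ⊎ (w ≡ 0 × ¬ P)

𝟙-reflects : ∀ {p} {P : Set p} (d : Dec P) → 𝟙 d reflects P
𝟙-reflects (yes p) = inj₁ (refl , p)
𝟙-reflects (no ¬p) = inj₂ (refl , ¬p)

1-reflects-⊤ : 1 reflects ⊤
1-reflects-⊤ = inj₁ (refl , tt)

*-reflects : ∀ {p q} {P : Set p} {Q : Set q} {w v : ℕ} → w reflects P → v reflects Q → (w * v) reflects (P × Q)
*-reflects (inj₁ (refl , p)) (inj₁ (refl , q)) = inj₁ (refl , p , q)
*-reflects (inj₁ (refl , _)) (inj₂ (refl , ¬q)) = inj₂ (refl , λ pq → ¬q (proj₂ pq))
*-reflects (inj₂ (refl , ¬p)) _                 = inj₂ (refl , λ pq → ¬p (proj₁ pq))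

reflects-⇔ : ∀ {p q} {P : Set p} {Q : Set q} {w : ℕ} → (P → Q) → (Q → P) → w reflects P → w reflects Q
reflects-⇔ f g (inj₁ (e , p))  = inj₁ (e , f p)
reflects-⇔ f g (inj₂ (e , ¬p)) = inj₂ (e , λ q → ¬p (g q))

sumBelow : ℕ → (ℕ → ℕ) → ℕ
sumBelow zero    f = 0
sumBelow (suc l) f = f 0 + sumBelow l (λ j → f (suc j))

sumBelow-cong : ∀ l {f g : ℕ → ℕ} → (∀ j → j < l → f j ≡ g j) → sumBelow l f ≡ sumBelow l g
sumBelow-cong zero    h = refl
sumBelow-cong (suc l) h = cong₂ _+_ (h 0 (s≤s z≤n)) (sumBelow-cong l (λ j j<l → h (suc j) (s≤s j<l)))

sumBelow-+ : ∀ l (f g : ℕ → ℕ) → sumBelow l (λ j → f j + g j) ≡ sumBelow l f + sumBelow l g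
sumBelow-+ zero    f g = refl
sumBelow-+ (suc l) f g rewrite sumBelow-+ l (λ j → f (suc j)) (λ j → g (suc j)) =
  solve 4 (λ a b x y → (a :+ b) :+ (x :+ y) := (a :+ x) :+ (b :+ y)) refl (f 0) (g 0) _ _

sumBelow-* : ∀ l a (f : ℕ → ℕ) → sumBelow l (λ j → a * f j) ≡ a * sumBelow l f
sumBelow-* zero    a f = sym (*-zeroʳ a)
sumBelow-* (suc l) a f rewrite sumBelow-* l a (λ j → f (suc j)) = sym (*-distribˡ-+ a (f 0) _)

sumBelow-zero : ∀ l (f : ℕ → ℕ) → (∀ j → j < l → f j ≡ 0) → sumBelow l f ≡ 0
sumBelow-zero zero    f h = refl
sumBelow-zero (suc l) f h rewrite h 0 (s≤s z≤n) = sumBelow-zero l _ (λ j j<l → h (suc j) (s≤s j<l))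

sumBelow-single : ∀ l (f : ℕ → ℕ) v → v < l → (∀ j → j < l → j ≢ v → f j ≡ 0) → sumBelow l f ≡ f v
sumBelow-single (suc l) f zero v<l h =
  trans (cong (f 0 +_) (sumBelow-zero l _ (λ j j<l → h (suc j) (s≤s j<l) (λ ())))) (+-identityʳ _)
sumBelow-single (suc l) f (suc v) (s≤s v<l) h rewrite h 0 (s≤s z≤n) (λ ()) =
  sumBelow-single l (λ j → f (suc j)) v v<l (λ j j<l j≢v → h (suc j) (s≤s j<l) (λ e → j≢v (suc-injective e)))

sumBelow-split : ∀ s d (f : ℕ → ℕ) → sumBelow (s + d) f ≡ sumBelow s f + sumBelow d (λ j → f (s + j))
sumBelow-split zero    d f = refl
sumBelow-split (suc s) d f rewrite sumBelow-split s d (λ j → f (suc j)) = sym (+-assoc (f 0) _ _)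

sumBelow-snoc : ∀ l (f : ℕ → ℕ) → sumBelow (suc l) f ≡ sumBelow l f + f l
sumBelow-snoc l f = begin
  sumBelow (suc l) f                         ≡⟨ cong (λ x → sumBelow x f) (+-comm 1 l) ⟩
  sumBelow (l + 1) f                         ≡⟨ sumBelow-split l 1 f ⟩
  sumBelow l f + (f (l + 0) + 0)             ≡⟨ cong (sumBelow l f +_) (trans (+-identityʳ _) (cong f (+-identityʳ l))) ⟩
  sumBelow l f + f l                         ∎

sumBelow-swap : ∀ l l' (F : ℕ → ℕ → ℕ) →
  sumBelow l (λ j → sumBelow l' (λ k → F j k)) ≡ sumBelow l' (λ k → sumBelow l (λ j → F j k))
sumBelow-swap zero    l' F = sym (sumBelow-zero l' _ (λ _ _ → refl))
sumBelow-swap (suc l) l' F rewrite sumBelow-swap l l' (λ j k → F (suc j) k) = sym (sumBelow-+ l' (F 0) _)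

sum-applyUpTo : ∀ (f : ℕ → ℕ) l → sum (applyUpTo f l) ≡ sumBelow l f
sum-applyUpTo f zero    = refl
sum-applyUpTo f (suc l) = cong (f 0 +_) (sum-applyUpTo (λ j → f (suc j)) l)

sumSeqs : ℕ → ℕ → (List ℕ → ℕ) → ℕ
sumSeqs n zero    f = f []
sumSeqs n (suc L) f = sumBelow n (λ j → sumSeqs n L (λ c → f (suc j ∷ c)))

InRange : ℕ → List ℕ → Set
InRange n c = All (λ x → 1 ≤ x × x ≤ n) c

sumSeqs-cong : ∀ n L {f g : List ℕ → ℕ} → (∀ c → length c ≡ L → InRange n c → f c ≡ g c) → sumSeqs n L f ≡ sumSeqs n L g
sumSeqs-cong n zero    h = h [] refl []
sumSeqs-cong n (suc L) h =
  sumBelow-cong n (λ j j<n → sumSeqs-cong n L (λ c lc sc → h (suc j ∷ c) (cong suc lc) ((s≤s z≤n , j<n) ∷ sc)))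

sumSeqs-zero : ∀ n L (f : List ℕ → ℕ) → (∀ c → length c ≡ L → InRange n c → f c ≡ 0) → sumSeqs n L f ≡ 0
sumSeqs-zero n zero    f h = h [] refl []
sumSeqs-zero n (suc L) f h =
  sumBelow-zero n _ (λ j j<n → sumSeqs-zero n L _ (λ c lc sc → h (suc j ∷ c) (cong suc lc) ((s≤s z≤n , j<n) ∷ sc)))

sumSeqs-sumBelow : ∀ n L l (F : ℕ → List ℕ → ℕ) →
  sumSeqs n L (λ c → sumBelow l (λ j → F j c)) ≡ sumBelow l (λ j → sumSeqs n L (F j))
sumSeqs-sumBelow n zero    l F = refl
sumSeqs-sumBelow n (suc L) l F =
  trans (sumBelow-cong n (λ x _ → sumSeqs-sumBelow n L l (λ j c → F j (suc x ∷ c))))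
        (sumBelow-swap n l (λ x j → sumSeqs n L (λ c → F j (suc x ∷ c))))

sumSeqs-one : ∀ r → sumSeqs 1 r (λ _ → 1) ≡ 1
sumSeqs-one zero    = refl
sumSeqs-one (suc r) = trans (+-identityʳ _) (sumSeqs-one r)

sumOver : {A : Set} → (A → ℕ) → List A → ℕ
sumOver f []       = 0
sumOver f (x ∷ xs) = f x + sumOver f xs

sumOver-++ : {A : Set} (f : A → ℕ) (xs ys : List A) → sumOver f (xs ++ ys) ≡ sumOver f xs + sumOver f ys
sumOver-++ f []       ys = refl
sumOver-++ f (x ∷ xs) ys rewrite sumOver-++ f xs ys = sym (+-assoc (f x) _ _)

sumOver-map : {A B : Set} (f : B → ℕ) (h : A → B) (xs : List A) → sumOver f (map h xs) ≡ sumOver (λ x → f (h x)) xs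
sumOver-map f h []       = refl
sumOver-map f h (x ∷ xs) = cong (f (h x) +_) (sumOver-map f h xs)

sumOver-concat : {A : Set} (f : A → ℕ) (xss : List (List A)) → sumOver f (concat xss) ≡ sumOver (sumOver f) xss
sumOver-concat f []         = refl
sumOver-concat f (xs ∷ xss) = trans (sumOver-++ f xs (concat xss)) (cong (sumOver f xs +_) (sumOver-concat f xss))

sumOver-cong : {A : Set} {f g : A → ℕ} (xs : List A) → (∀ x → f x ≡ g x) → sumOver f xs ≡ sumOver g xs
sumOver-cong []       h = refl
sumOver-cong (x ∷ xs) h = cong₂ _+_ (h x) (sumOver-cong xs h)

sumOver-applyUpTo : (f g : ℕ → ℕ) (l : ℕ) → sumOver f (applyUpTo g l) ≡ sumBelow l (λ j → f (g j))
sumOver-applyUpTo f g zero    = refl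
sumOver-applyUpTo f g (suc l) = cong (f (g 0) +_) (sumOver-applyUpTo f (λ j → g (suc j)) l)

length-filter : {A : Set} {ℓ : Level} {P : Pred A ℓ} (P? : Decidable P) (xs : List A) →
  length (filter P? xs) ≡ sumOver (λ x → 𝟙 (P? x)) xs
length-filter P? [] = refl
length-filter P? (x ∷ xs) with P? x
... | yes _ = cong suc (length-filter P? xs)
... | no _  = length-filter P? xs

sumOver-seqs : ∀ n L (f : List ℕ → ℕ) → sumOver f (seqs n L) ≡ sumSeqs n L f
sumOver-seqs n zero    f = +-identityʳ _
sumOver-seqs n (suc L) f = begin
  sumOver f (concat (map (λ x → map (x ∷_) (seqs n L)) [ n ]))
    ≡⟨ sumOver-concat f (map (λ x → map (x ∷_) (seqs n L)) [ n ]) ⟩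
  sumOver (sumOver f) (map (λ x → map (x ∷_) (seqs n L)) [ n ])
    ≡⟨ sumOver-map (sumOver f) (λ x → map (x ∷_) (seqs n L)) [ n ] ⟩
  sumOver (λ x → sumOver f (map (x ∷_) (seqs n L))) [ n ]
    ≡⟨ sumOver-cong [ n ] (λ x → trans (sumOver-map f (x ∷_) (seqs n L)) (sumOver-seqs n L (λ c → f (x ∷ c)))) ⟩
  sumOver (λ x → sumSeqs n L (λ c → f (x ∷ c))) [ n ]
    ≡⟨ sumOver-applyUpTo (λ x → sumSeqs n L (λ c → f (x ∷ c))) suc n ⟩
  sumSeqs n (suc L) f ∎

count-filter : ∀ n L {ℓ : Level} {P : Pred (List ℕ) ℓ} (P? : Decidable P) →
  length (filter P? (seqs n L)) ≡ sumSeqs n L (λ c → 𝟙 (P? c))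
count-filter n L P? = trans (length-filter P? (seqs n L)) (sumOver-seqs n L _)

#≤ : ℕ → List ℕ → ℕ
#≤ x [] = 0
#≤ x (y ∷ c) with y ≤? x
... | yes _ = suc (#≤ x c)
... | no _  = #≤ x c

below : ℕ → List ℕ → List ℕ
below s [] = []
below s (x ∷ c) with x ≤? s
... | yes _ = x ∷ below s c
... | no _  = below s c

above : ℕ → List ℕ → List ℕ
above s [] = []
above s (x ∷ c) with x ≤? s
... | yes _ = above s c
... | no _  = (x ∸ s) ∷ above s c

#≤-cons : ∀ x y c → #≤ x (y ∷ c) ≡ 𝟙 (y ≤? x) + #≤ x c
#≤-cons x y c with y ≤? x
... | yes _ = refl
... | no _  = refl

#≤-yes : ∀ x y c → y ≤ x → #≤ x (y ∷ c) ≡ suc (#≤ x c)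
#≤-yes x y c p rewrite #≤-cons x y c | 𝟙-yes (y ≤? x) p = refl

#≤-no : ∀ x y c → ¬ y ≤ x → #≤ x (y ∷ c) ≡ #≤ x c
#≤-no x y c p rewrite #≤-cons x y c | 𝟙-no (y ≤? x) p = refl

below-yes : ∀ s x c → x ≤ s → below s (x ∷ c) ≡ x ∷ below s c
below-yes s x c p with x ≤? s
... | yes _ = refl
... | no q  = ⊥-elim (q p)

below-no : ∀ s x c → ¬ x ≤ s → below s (x ∷ c) ≡ below s c
below-no s x c p with x ≤? s
... | yes q = ⊥-elim (p q)
... | no _  = refl

above-yes : ∀ s x c → x ≤ s → above s (x ∷ c) ≡ above s c
above-yes s x c p with x ≤? s
... | yes _ = refl
... | no q  = ⊥-elim (q p)

above-no : ∀ s x c → ¬ x ≤ s → above s (x ∷ c) ≡ (x ∸ s) ∷ above s c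
above-no s x c p with x ≤? s
... | yes q = ⊥-elim (p q)
... | no _  = refl

length-below : ∀ s c → length (below s c) ≡ #≤ s c
length-below s [] = refl
length-below s (y ∷ c) with y ≤? s
... | yes _ = cong suc (length-below s c)
... | no _  = length-below s c

#≤-length : ∀ x c → #≤ x c ≤ length c
#≤-length x [] = z≤n
#≤-length x (y ∷ c) with y ≤? x
... | yes _ = s≤s (#≤-length x c)
... | no _  = m≤n⇒m≤1+n (#≤-length x c)

#≤-mono : ∀ {x y} c → x ≤ y → #≤ x c ≤ #≤ y c
#≤-mono [] p = z≤n
#≤-mono {x} {y} (z ∷ c) p with z ≤? x
... | yes q = ≤-trans (s≤s (#≤-mono c p)) (≤-reflexive (sym (#≤-yes y z c (≤-trans q p))))
... | no q with z ≤? y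
...   | yes _ = m≤n⇒m≤1+n (#≤-mono c p)
...   | no _  = #≤-mono c p

#≤-below : ∀ x s c → x ≤ s → #≤ x (below s c) ≡ #≤ x c
#≤-below x s [] p = refl
#≤-below x s (y ∷ c) p with y ≤? s
... | yes q = trans (#≤-cons x y (below s c)) (trans (cong (𝟙 (y ≤? x) +_) (#≤-below x s c p)) (sym (#≤-cons x y c)))
... | no q  = trans (#≤-below x s c p) (sym (#≤-no x y c (λ y≤x → q (≤-trans y≤x p))))

#≤-above : ∀ y s c → #≤ y (above s c) + #≤ s c ≡ #≤ (s + y) c
#≤-above y s [] = refl
#≤-above y s (x ∷ c) with x ≤? s
... | yes p = trans (+-suc _ _) (trans (cong suc (#≤-above y s c)) (sym (#≤-yes (s + y) x c (≤-trans p (m≤m+n s y)))))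
... | no p with x ∸ s ≤? y
...   | yes q = trans (cong suc (#≤-above y s c)) (sym (#≤-yes (s + y) x c x≤s+y))
  where x≤s+y : x ≤ s + y
        x≤s+y = subst (_≤ s + y) (m+[n∸m]≡n (<⇒≤ (≰⇒> p))) (+-monoʳ-≤ s q)
...   | no q = trans (#≤-above y s c)
                 (sym (#≤-no (s + y) x c (λ r → q (≤-trans (∸-monoˡ-≤ s r) (≤-reflexive (m+n∸m≡n s y))))))

#≤-↭ : ∀ x {c d} → c ↭ d → #≤ x c ≡ #≤ x d
#≤-↭ x Perm.refl = refl
#≤-↭ x (prep y p) = trans (#≤-cons x y _) (trans (cong (𝟙 (y ≤? x) +_) (#≤-↭ x p)) (sym (#≤-cons x y _)))
#≤-↭ x (swap {xs} {ys} y z p) = begin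
  #≤ x (y ∷ z ∷ xs)                        ≡⟨ #≤-cons x y (z ∷ xs) ⟩
  𝟙 (y ≤? x) + #≤ x (z ∷ xs)               ≡⟨ cong (𝟙 (y ≤? x) +_) (#≤-cons x z xs) ⟩
  𝟙 (y ≤? x) + (𝟙 (z ≤? x) + #≤ x xs)      ≡⟨ solve 3 (λ a b t → a :+ (b :+ t) := b :+ (a :+ t)) refl (𝟙 (y ≤? x)) (𝟙 (z ≤? x)) _ ⟩
  𝟙 (z ≤? x) + (𝟙 (y ≤? x) + #≤ x xs)      ≡⟨ cong (λ t → 𝟙 (z ≤? x) + (𝟙 (y ≤? x) + t)) (#≤-↭ x p) ⟩
  𝟙 (z ≤? x) + (𝟙 (y ≤? x) + #≤ x ys)      ≡⟨ cong (𝟙 (z ≤? x) +_) (sym (#≤-cons x y ys)) ⟩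
  𝟙 (z ≤? x) + #≤ x (y ∷ ys)               ≡⟨ sym (#≤-cons x z (y ∷ ys)) ⟩
  #≤ x (z ∷ y ∷ ys)                        ∎
#≤-↭ x (Perm.trans p q) = trans (#≤-↭ x p) (#≤-↭ x q)

#≤-zero : ∀ n c → InRange n c → #≤ 0 c ≡ 0
#≤-zero n [] _ = refl
#≤-zero n (y ∷ c) ((1≤y , _) ∷ sc) = trans (#≤-no 0 y c (λ y≤0 → 1+n≰n (≤-trans 1≤y y≤0))) (#≤-zero n c sc)

#≤-none : ∀ b s → All (λ x → ¬ x ≤ b) s → #≤ b s ≡ 0
#≤-none b [] _ = refl
#≤-none b (x ∷ s) (p ∷ ps) = trans (#≤-no b x s p) (#≤-none b s ps)

binom : ℕ → ℕ → ℕ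
binom _       zero    = 1
binom zero    (suc k) = 0
binom (suc n) (suc k) = binom n k + binom n (suc k)

binom-0 : ∀ n k → n < k → binom n k ≡ 0
binom-0 zero (suc k) _ = refl
binom-0 (suc n) (suc k) (s≤s p) rewrite binom-0 n k p | binom-0 n (suc k) (m≤n⇒m≤1+n p) = refl

binom-n-n : ∀ n → binom n n ≡ 1
binom-n-n zero = refl
binom-n-n (suc n) rewrite binom-n-n n | binom-0 n (suc n) (n<1+n n) = refl

binom≡C : ∀ a b → binom a b ≡ a C b
binom≡C a       zero    = refl
binom≡C zero    (suc b) = sym (k>n⇒nCk≡0 {0} {suc b} (s≤s z≤n))
binom≡C (suc a) (suc b) = trans (cong₂ _+_ (binom≡C a b) (binom≡C a (suc b))) (nCk+nC[k+1]≡[n+1]C[k+1] a b)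

splitWeight : ℕ → ℕ → (List ℕ → ℕ) → (List ℕ → ℕ) → List ℕ → ℕ
splitWeight s k f g c = 𝟙 (length (below s c) ≟ k) * f (below s c) * g (above s c)

-- Splitting lemma: choosing the k positions of the small entries,
--   Σ_{c ∈ [s+d]^L} splitWeight s k f g c = C(L,k) · Σ_{[s]^k} f · Σ_{[d]^(L-k)} g.
private
  large-first : ∀ s d L k (f g : List ℕ → ℕ) j →
    sumSeqs (s + d) L (λ c → splitWeight s k f g (suc (s + j) ∷ c))
      ≡ sumSeqs (s + d) L (splitWeight s k f (λ c → g (suc j ∷ c)))
  large-first s d L k f g j = sumSeqs-cong (s + d) L (λ c _ _ →
    cong₂ (λ u v → 𝟙 (length u ≟ k) * f u * g v) (below-no s _ c s+j≰s)
          (trans (above-no s _ c s+j≰s) (cong (_∷ above s c) (trans (cong (_∸ s) (sym (+-suc s j))) (m+n∸m≡n s (suc j))))))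
    where s+j≰s : ¬ suc (s + j) ≤ s
          s+j≰s p = 1+n≰n (≤-trans (s≤s (m≤m+n s j)) p)

  small-first : ∀ s d L k (f g : List ℕ → ℕ) j → j < s →
    sumSeqs (s + d) L (λ c → splitWeight s k f g (suc j ∷ c))
      ≡ sumSeqs (s + d) L (λ c → 𝟙 (suc (length (below s c)) ≟ k) * f (suc j ∷ below s c) * g (above s c))
  small-first s d L k f g j j<s = sumSeqs-cong (s + d) L (λ c _ _ →
    cong₂ (λ u v → 𝟙 (length u ≟ k) * f u * g v) (below-yes s (suc j) c j<s) (above-yes s (suc j) c j<s))

  large-part : ∀ s d L k (f g : List ℕ → ℕ) →
    (∀ g' → sumSeqs (s + d) L (splitWeight s k f g') ≡ binom L k * sumSeqs s k f * sumSeqs d (L ∸ k) g') →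
    sumBelow d (λ j → sumSeqs (s + d) L (λ c → splitWeight s k f g (suc (s + j) ∷ c)))
      ≡ binom L k * sumSeqs s k f * sumSeqs d (suc (L ∸ k)) g
  large-part s d L k f g ih =
    trans (sumBelow-cong d (λ j _ → trans (large-first s d L k f g j) (ih (λ c → g (suc j ∷ c)))))
          (sumBelow-* d (binom L k * sumSeqs s k f) _)

  sumBelow-*3 : ∀ l a b (X : ℕ → ℕ) → sumBelow l (λ j → a * X j * b) ≡ a * sumBelow l X * b
  sumBelow-*3 l a b X = begin
    sumBelow l (λ j → a * X j * b)   ≡⟨ sumBelow-cong l (λ j _ → solve 3 (λ a b x → a :* x :* b := (a :* b) :* x) refl a b (X j)) ⟩
    sumBelow l (λ j → a * b * X j)   ≡⟨ sumBelow-* l (a * b) X ⟩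
    a * b * sumBelow l X             ≡⟨ solve 3 (λ a b x → (a :* b) :* x := a :* x :* b) refl a b (sumBelow l X) ⟩
    a * sumBelow l X * b             ∎

  pascal-combine : ∀ a b X Y Y' → (b ≡ 0 ⊎ Y' ≡ Y) → a * X * Y + b * X * Y' ≡ (a + b) * X * Y
  pascal-combine a b X Y Y' (inj₁ refl) = trans (+-identityʳ _) (cong (λ t → t * X * Y) (sym (+-identityʳ a)))
  pascal-combine a b X Y Y' (inj₂ refl) = solve 4 (λ a b X Y → a :* X :* Y :+ b :* X :* Y := (a :+ b) :* X :* Y) refl a b X Y

sumSeqs-split : ∀ s d L k (f g : List ℕ → ℕ) →
  sumSeqs (s + d) L (splitWeight s k f g) ≡ binom L k * sumSeqs s k f * sumSeqs d (L ∸ k) g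
sumSeqs-split s d zero zero    f g = refl
sumSeqs-split s d zero (suc k) f g = refl
sumSeqs-split s d (suc L) zero f g =
  trans (sumBelow-split s d _)
        (cong₂ _+_ (sumBelow-zero s _ (λ j j<s → trans (small-first s d L zero f g j j<s) (sumSeqs-zero (s + d) L _ (λ _ _ _ → refl))))
                   (large-part s d L zero f g (sumSeqs-split s d L zero f)))
sumSeqs-split s d (suc L) (suc k) f g =
  trans (sumBelow-split s d _)
        (trans (cong₂ _+_ small-part (large-part s d L (suc k) f g (sumSeqs-split s d L (suc k) f)))
               (pascal-combine (binom L k) (binom L (suc k)) (sumSeqs s (suc k) f) (sumSeqs d (L ∸ k) g) _ exponents))
  where
  small-part : sumBelow s (λ j → sumSeqs (s + d) L (λ c → splitWeight s (suc k) f g (suc j ∷ c)))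
                 ≡ binom L k * sumSeqs s (suc k) f * sumSeqs d (L ∸ k) g
  small-part = trans (sumBelow-cong s (λ j j<s → trans (small-first s d L (suc k) f g j j<s)
                 (trans (sumSeqs-cong (s + d) L (λ c _ _ → cong (λ t → t * f (suc j ∷ below s c) * g (above s c))
                          (𝟙-⇔ (suc (length (below s c)) ≟ suc k) (length (below s c) ≟ k) suc-injective (cong suc))))
                        (sumSeqs-split s d L k (λ c → f (suc j ∷ c)) g))))
                 (sumBelow-*3 s (binom L k) (sumSeqs d (L ∸ k) g) _)
  exponents : binom L (suc k) ≡ 0 ⊎ sumSeqs d (suc (L ∸ suc k)) g ≡ sumSeqs d (L ∸ k) g
  exponents with suc k ≤? L
  ... | yes p = inj₂ (cong (λ t → sumSeqs d t g) (sym (+-∸-assoc 1 p)))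
  ... | no p  = inj₁ (binom-0 L (suc k) (≰⇒> p))

abelSum : ℕ → ℕ → ℕ → ℕ
abelSum L a B = sumBelow (suc L) (λ r → binom L r * (a + r) * B ^ (L ∸ r))

abelSum-scaled : ∀ L a B → B * abelSum L a B
  ≡ 1 * (a + 0) * B ^ suc L + sumBelow L (λ r → binom L (suc r) * (a + suc r) * B ^ (L ∸ r))
abelSum-scaled L a B = begin
  B * abelSum L a B
    ≡⟨ sym (sumBelow-* (suc L) B (λ r → binom L r * (a + r) * B ^ (L ∸ r))) ⟩
  B * (1 * (a + 0) * B ^ L) + sumBelow L (λ r → B * (binom L (suc r) * (a + suc r) * B ^ (L ∸ suc r)))
    ≡⟨ cong₂ _+_ (solve 3 (λ B a Y → B :* (con 1 :* (a :+ con 0) :* Y) := con 1 :* (a :+ con 0) :* (B :* Y)) refl B a (B ^ L))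
                 (sumBelow-cong L shift) ⟩
  1 * (a + 0) * B ^ suc L + sumBelow L (λ r → binom L (suc r) * (a + suc r) * B ^ (L ∸ r)) ∎
  where
  shift : ∀ r → r < L → B * (binom L (suc r) * (a + suc r) * B ^ (L ∸ suc r)) ≡ binom L (suc r) * (a + suc r) * B ^ (L ∸ r)
  shift r r<L = trans (solve 4 (λ B x y z → B :* (x :* y :* z) := x :* y :* (B :* z)) refl B (binom L (suc r)) (a + suc r) (B ^ (L ∸ suc r)))
                      (cong (λ t → binom L (suc r) * (a + suc r) * B ^ t) (sym (+-∸-assoc 1 r<L)))

-- Pascal's rule splits abelSum (L+1) into a scaled and a shifted copy.
abelSum-rec : ∀ L a B → abelSum (suc L) a B ≡ B * abelSum L a B + abelSum L (suc a) B
abelSum-rec L a B = begin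
  abelSum (suc L) a B
    ≡⟨⟩
  t₀ + sumBelow (suc L) (λ r → (binom L r + binom L (suc r)) * (a + suc r) * B ^ (L ∸ r))
    ≡⟨ cong (t₀ +_) (trans (sumBelow-cong (suc L) (λ r _ → distrib r)) (sumBelow-+ (suc L) left right)) ⟩
  t₀ + (sumBelow (suc L) left + sumBelow (suc L) right)
    ≡⟨ cong₂ (λ x y → t₀ + (x + y)) (sumBelow-cong (suc L) (λ r _ → cong (λ t → binom L r * t * B ^ (L ∸ r)) (+-suc a r)))
                                     (sumBelow-snoc L right) ⟩
  t₀ + (abelSum L (suc a) B + (sumBelow L right + right L))
    ≡⟨ cong (λ z → t₀ + (abelSum L (suc a) B + (sumBelow L right + z * (a + suc L) * B ^ (L ∸ L)))) (binom-0 L (suc L) (n<1+n L)) ⟩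
  t₀ + (abelSum L (suc a) B + (sumBelow L right + 0))
    ≡⟨ solve 3 (λ x y z → x :+ (y :+ (z :+ con 0)) := (x :+ z) :+ y) refl t₀ (abelSum L (suc a) B) (sumBelow L right) ⟩
  (t₀ + sumBelow L right) + abelSum L (suc a) B
    ≡⟨ cong (_+ abelSum L (suc a) B) (sym (abelSum-scaled L a B)) ⟩
  B * abelSum L a B + abelSum L (suc a) B ∎
  where
  t₀ = 1 * (a + 0) * B ^ suc L
  left right : ℕ → ℕ
  left  r = binom L r * (a + suc r) * B ^ (L ∸ r)
  right r = binom L (suc r) * (a + suc r) * B ^ (L ∸ r)
  distrib : ∀ r → (binom L r + binom L (suc r)) * (a + suc r) * B ^ (L ∸ r) ≡ left r + right r
  distrib r = solve 4 (λ x y A Q → (x :+ y) :* A :* Q := x :* A :* Q :+ y :* A :* Q) refl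
                (binom L r) (binom L (suc r)) (a + suc r) (B ^ (L ∸ r))

abelSum-closed : ∀ L a B → abelSum L a B * suc B ≡ (a * suc B + L) * suc B ^ L
abelSum-closed zero a B =
  solve 2 (λ a B → (con 1 :* (a :+ con 0) :* con 1 :+ con 0) :* (con 1 :+ B) := (a :* (con 1 :+ B) :+ con 0) :* con 1) refl a B
abelSum-closed (suc L) a B = begin
  abelSum (suc L) a B * suc B
    ≡⟨ cong (_* suc B) (abelSum-rec L a B) ⟩
  (B * abelSum L a B + abelSum L (suc a) B) * suc B
    ≡⟨ solve 3 (λ B x y → (B :* x :+ y) :* (con 1 :+ B) := B :* (x :* (con 1 :+ B)) :+ y :* (con 1 :+ B)) refl B (abelSum L a B) (abelSum L (suc a) B) ⟩
  B * (abelSum L a B * suc B) + abelSum L (suc a) B * suc B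
    ≡⟨ cong₂ (λ x y → B * x + y) (abelSum-closed L a B) (abelSum-closed L (suc a) B) ⟩
  B * ((a * suc B + L) * suc B ^ L) + (suc a * suc B + L) * suc B ^ L
    ≡⟨ solve 4 (λ a B L X → B :* ((a :* (con 1 :+ B) :+ L) :* X) :+ ((con 1 :+ a) :* (con 1 :+ B) :+ L) :* X
                          := (a :* (con 1 :+ B) :+ (con 1 :+ L)) :* ((con 1 :+ B) :* X)) refl a B L (suc B ^ L) ⟩
  (a * suc B + suc L) * suc B ^ suc L ∎

-- pfCount L b = b (b+L)^(L-1): the number of generalized parking sequences
-- of length L with b free spots in front (for L = 0 the empty sequence).
pfCount : ℕ → ℕ → ℕ
pfCount zero    b = 1
pfCount (suc L) b = b * (b + suc L) ^ L

abel : ∀ L a → sumBelow (suc L) (λ r → binom L r * pfCount (L ∸ r) (a + r)) ≡ pfCount L (suc a)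
abel zero a = refl
abel (suc L') a = trans (trans (sumBelow-snoc L F) (cong (sumBelow L F +_) last)) (*-cancelʳ-≡ _ _ (B * suc B) {{nonZero}} scaled)
  where
  L = suc L'
  B = a + suc L'
  nonZero : NonZero (B * suc B)
  nonZero = subst (λ t → NonZero (t * suc t)) (sym (+-suc a L')) _
  F : ℕ → ℕ
  F r = binom L r * pfCount (L ∸ r) (a + r)
  last : F L ≡ 1
  last rewrite binom-n-n L | n∸n≡0 L = refl
  term-scaled : ∀ r → r < suc L → B * F r ≡ binom L r * (a + r) * B ^ (L ∸ r)
  term-scaled r (s≤s r≤L) with m≤n⇒m<n∨m≡n r≤L
  ... | inj₂ refl rewrite last | binom-n-n L | n∸n≡0 L = trans (*-identityʳ B) (sym (trans (*-identityʳ _) (+-identityʳ B)))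
  ... | inj₁ (s≤s r≤L') rewrite +-∸-assoc 1 r≤L' =
    trans (cong (λ t → B * (binom L r * ((a + r) * t ^ (L' ∸ r)))) base)
          (solve 4 (λ B x y z → B :* (x :* (y :* z)) := x :* y :* (B :* z)) refl B (binom L r) (a + r) (B ^ (L' ∸ r)))
    where
    base : a + r + suc (L' ∸ r) ≡ B
    base = trans (+-assoc a r _) (cong (a +_) (trans (+-suc r _) (cong suc (m+[n∸m]≡n r≤L'))))
  sum-scaled : B * (sumBelow L F + 1) ≡ abelSum L a B
  sum-scaled = begin
    B * (sumBelow L F + 1)           ≡⟨ cong (B *_) (trans (cong (sumBelow L F +_) (sym last)) (sym (sumBelow-snoc L F))) ⟩
    B * sumBelow (suc L) F           ≡⟨ sym (sumBelow-* (suc L) B F) ⟩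
    sumBelow (suc L) (λ r → B * F r) ≡⟨ sumBelow-cong (suc L) term-scaled ⟩
    abelSum L a B                    ∎
  scaled : (sumBelow L F + 1) * (B * suc B) ≡ pfCount L (suc a) * (B * suc B)
  scaled = begin
    (sumBelow L F + 1) * (B * suc B)      ≡⟨ solve 2 (λ B x → x :* (B :* (con 1 :+ B)) := (B :* x) :* (con 1 :+ B)) refl B (sumBelow L F + 1) ⟩
    B * (sumBelow L F + 1) * suc B        ≡⟨ cong (_* suc B) sum-scaled ⟩
    abelSum L a B * suc B                 ≡⟨ abelSum-closed L a B ⟩
    (a * suc B + L) * suc B ^ L           ≡⟨ solve 3 (λ a L' X → (a :* (con 1 :+ (a :+ (con 1 :+ L'))) :+ (con 1 :+ L')) :* ((con 1 :+ (a :+ (con 1 :+ L'))) :* X)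
                                                    := ((con 1 :+ a) :* X) :* ((a :+ (con 1 :+ L')) :* (con 1 :+ (a :+ (con 1 :+ L'))))) refl a L' (suc B ^ L') ⟩
    pfCount L (suc a) * (B * suc B)       ∎

<∸⇒+< : ∀ k m n → m < n ∸ k → k + m < n
<∸⇒+< zero    m n       p = p
<∸⇒+< (suc k) m zero    ()
<∸⇒+< (suc k) m (suc n) p = s≤s (<∸⇒+< k m n p)

-- c "parks L cars after b free spots": for every j < L at least j+1 entries are ≤ b+j.
-- Parks 1 L c says that c is a parking function of length L.
Parks : ℕ → ℕ → List ℕ → Set
Parks b L c = ∀ {j} → j < L → suc j ≤ #≤ (b + j) c

parks? : ∀ b L c → Dec (Parks b L c)
parks? b L c = allUpTo? (λ j → suc j ≤? #≤ (b + j) c) L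

parksWeight : ℕ → ℕ → List ℕ → ℕ
parksWeight b L c = 𝟙 (parks? b L c)

-- Removing the r = #≤ 1 c entries equal to 1 turns b+1 free spots into b+r,
-- with r fewer cars left to park.
module _ (a L : ℕ) (c : List ℕ) where
  private
    r₁ = #≤ 1 c

  parks-drop-ones : Parks (suc a) L c → Parks (a + r₁) (L ∸ r₁) (above 1 c)
  parks-drop-ones h {j} j<L∸r₁ = +-cancelʳ-≤ r₁ (suc j) _ (subst₂ _≤_ count-shift entries-shift (h (<∸⇒+< r₁ j L j<L∸r₁)))
    where
    count-shift : suc (r₁ + j) ≡ suc j + r₁
    count-shift = cong suc (+-comm r₁ j)
    entries-shift : #≤ (suc a + (r₁ + j)) c ≡ #≤ (a + r₁ + j) (above 1 c) + r₁
    entries-shift = trans (cong (λ t → #≤ (suc t) c) (sym (+-assoc a r₁ j))) (sym (#≤-above (a + r₁ + j) 1 c))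

  parks-add-ones : Parks (a + r₁) (L ∸ r₁) (above 1 c) → Parks (suc a) L c
  parks-add-ones h {j} j<L with j <? r₁
  ... | yes j<r₁ = ≤-trans j<r₁ (#≤-mono c (s≤s z≤n))
  ... | no j≮r₁ = subst₂ _≤_ count-shift entries-shift (+-monoˡ-≤ r₁ (h (∸-monoˡ-< j<L r₁≤j)))
    where
    r₁≤j = ≮⇒≥ j≮r₁
    count-shift : suc (j ∸ r₁) + r₁ ≡ suc j
    count-shift = cong suc (m∸n+n≡m r₁≤j)
    entries-shift : #≤ (a + r₁ + (j ∸ r₁)) (above 1 c) + r₁ ≡ #≤ (suc a + j) c
    entries-shift = trans (#≤-above (a + r₁ + (j ∸ r₁)) 1 c)
                          (cong (λ t → #≤ (suc t) c) (trans (+-assoc a r₁ (j ∸ r₁)) (cong (a +_) (m+[n∸m]≡n r₁≤j))))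

parks-by-ones : ∀ a L c → length c ≡ L →
  parksWeight (suc a) L c ≡ sumBelow (suc L) (λ r → splitWeight 1 r (λ _ → 1) (parksWeight (a + r) (L ∸ r)) c)
parks-by-ones a L c lc = sym (begin
  sumBelow (suc L) (λ r → splitWeight 1 r (λ _ → 1) (parksWeight (a + r) (L ∸ r)) c)
    ≡⟨ sumBelow-single (suc L) _ v v<1+L others ⟩
  𝟙 (v ≟ v) * 1 * parksWeight (a + v) (L ∸ v) (above 1 c)
    ≡⟨ cong (λ t → t * 1 * parksWeight (a + v) (L ∸ v) (above 1 c)) (𝟙-yes (v ≟ v) refl) ⟩
  parksWeight (a + v) (L ∸ v) (above 1 c) + 0
    ≡⟨ +-identityʳ _ ⟩
  parksWeight (a + v) (L ∸ v) (above 1 c)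
    ≡⟨ cong (λ t → parksWeight (a + t) (L ∸ t) (above 1 c)) (length-below 1 c) ⟩
  parksWeight (a + #≤ 1 c) (L ∸ #≤ 1 c) (above 1 c)
    ≡⟨ 𝟙-⇔ _ _ (parks-add-ones a L c) (parks-drop-ones a L c) ⟩
  parksWeight (suc a) L c ∎)
  where
  v = length (below 1 c)
  v<1+L : v < suc L
  v<1+L = s≤s (subst₂ _≤_ (sym (length-below 1 c)) lc (#≤-length 1 c))
  others : ∀ r → r < suc L → r ≢ v → splitWeight 1 r (λ _ → 1) (parksWeight (a + r) (L ∸ r)) c ≡ 0
  others r _ r≢v = cong (λ t → t * 1 * parksWeight (a + r) (L ∸ r) (above 1 c)) (𝟙-no (v ≟ r) (λ e → r≢v (sym e)))

-- Induction on L: split by the number r of ones (splitting lemma with s = 1),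
-- recurse on the rest, and sum with Abel's identity.
count-parks : ∀ n L b → b + L ≡ suc n → sumSeqs n L (parksWeight b L) ≡ pfCount L b
count-parks n zero b eq = 𝟙-yes (parks? b 0 []) (λ ())
count-parks n (suc L) zero eq = sumSeqs-zero n (suc L) _ (λ c lc sc → 𝟙-no (parks? 0 (suc L) c)
  (λ h → 1+n≰n (subst (1 ≤_) (#≤-zero n c sc) (h (s≤s z≤n)))))
count-parks zero (suc L) (suc a) eq with trans (sym (+-suc a L)) (suc-injective eq)
... | ()
count-parks (suc n) (suc L') (suc a) eq = begin
  sumSeqs (suc n) L (parksWeight (suc a) L)
    ≡⟨ sumSeqs-cong (suc n) L (λ c lc _ → parks-by-ones a L c lc) ⟩
  sumSeqs (suc n) L (λ c → sumBelow (suc L) (λ r → splitWeight 1 r (λ _ → 1) (parksWeight (a + r) (L ∸ r)) c))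
    ≡⟨ sumSeqs-sumBelow (suc n) L (suc L) (λ r → splitWeight 1 r (λ _ → 1) (parksWeight (a + r) (L ∸ r))) ⟩
  sumBelow (suc L) (λ r → sumSeqs (1 + n) L (splitWeight 1 r (λ _ → 1) (parksWeight (a + r) (L ∸ r))))
    ≡⟨ sumBelow-cong (suc L) (λ r r≤L → by-ones r (s≤s⁻¹ r≤L)) ⟩
  sumBelow (suc L) (λ r → binom L r * pfCount (L ∸ r) (a + r))
    ≡⟨ abel L a ⟩
  pfCount L (suc a) ∎
  where
  L = suc L'
  by-ones : ∀ r → r ≤ L → sumSeqs (1 + n) L (splitWeight 1 r (λ _ → 1) (parksWeight (a + r) (L ∸ r)))
                           ≡ binom L r * pfCount (L ∸ r) (a + r)
  by-ones r r≤L = begin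
    sumSeqs (1 + n) L (splitWeight 1 r (λ _ → 1) (parksWeight (a + r) (L ∸ r)))
      ≡⟨ sumSeqs-split 1 n L r (λ _ → 1) (parksWeight (a + r) (L ∸ r)) ⟩
    binom L r * sumSeqs 1 r (λ _ → 1) * sumSeqs n (L ∸ r) (parksWeight (a + r) (L ∸ r))
      ≡⟨ cong₂ (λ x y → binom L r * x * y) (sumSeqs-one r) (count-parks n (L ∸ r) (a + r) sizes) ⟩
    binom L r * 1 * pfCount (L ∸ r) (a + r)
      ≡⟨ cong (_* pfCount (L ∸ r) (a + r)) (*-identityʳ (binom L r)) ⟩
    binom L r * pfCount (L ∸ r) (a + r) ∎
    where
    sizes : a + r + (L ∸ r) ≡ suc n
    sizes = trans (+-assoc a r _) (trans (cong (a +_) (m+[n∸m]≡n r≤L)) (suc-injective eq))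

Dominated : ℕ → List ℕ → List ℕ → Set
Dominated j []      s = ⊤
Dominated j (b ∷ u) s = suc j ≤ #≤ b s × Dominated (suc j) u s

private
  linked-all : ∀ {b u} → Linked _≤_ (b ∷ u) → All (b ≤_) u
  linked-all [-]      = []
  linked-all (p ∷ l) = p ∷ All.map (≤-trans p) (linked-all l)

  linked-tail : ∀ {b u} → Linked _≤_ (b ∷ u) → Linked _≤_ u
  linked-tail [-]      = []
  linked-tail (p ∷ l) = l

dominated-cons⁺ : ∀ j a u s → All (a ≤_) u → Dominated j u s → Dominated (suc j) u (a ∷ s)
dominated-cons⁺ j a []      s _ _ = tt
dominated-cons⁺ j a (b ∷ u) s (a≤b ∷ al) (p , d) =
  subst (suc (suc j) ≤_) (sym (#≤-yes b a s a≤b)) (s≤s p) , dominated-cons⁺ (suc j) a u s al d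

dominated-cons⁻ : ∀ j a u s → All (a ≤_) u → Dominated (suc j) u (a ∷ s) → Dominated j u s
dominated-cons⁻ j a []      s _ _ = tt
dominated-cons⁻ j a (b ∷ u) s (a≤b ∷ al) (p , d) =
  s≤s⁻¹ (subst (suc (suc j) ≤_) (#≤-yes b a s a≤b) p) , dominated-cons⁻ (suc j) a u s al d

dominated-cong : ∀ j u {s s'} → (∀ x → #≤ x s ≡ #≤ x s') → Dominated j u s → Dominated j u s'
dominated-cong j []      h d       = tt
dominated-cong j (b ∷ u) h (p , d) = subst (suc j ≤_) (h b) p , dominated-cong (suc j) u h d

pointwise⇒dominated : ∀ {s u} → Linked _≤_ u → Pointwise _≤_ s u → Dominated 0 u s
pointwise⇒dominated lu [] = tt
pointwise⇒dominated {a ∷ s} {b ∷ u} lu (a≤b ∷ pw) =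
  subst (1 ≤_) (sym (#≤-yes b a s a≤b)) (s≤s z≤n) ,
  dominated-cons⁺ 0 a u s (All.map (≤-trans a≤b) (linked-all lu)) (pointwise⇒dominated (linked-tail lu) pw)

dominated⇒pointwise : ∀ s u → Linked _≤_ s → Linked _≤_ u → length s ≡ length u → Dominated 0 u s → Pointwise _≤_ s u
dominated⇒pointwise []      []      _  _  _  _ = []
dominated⇒pointwise (a ∷ s) (b ∷ u) ls lu eq (p , d) with a ≤? b
... | yes a≤b = a≤b ∷ dominated⇒pointwise s u (linked-tail ls) (linked-tail lu) (suc-injective eq)
                        (dominated-cons⁻ 0 a u s (All.map (≤-trans a≤b) (linked-all lu)) d)
... | no a≰b  = ⊥-elim (1+n≰n (subst (1 ≤_) (#≤-none b s (All.map (λ a≤x x≤b → a≰b (≤-trans a≤x x≤b)) (linked-all ls))) p))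

Fits : (ℕ → ℕ) → ℕ → List ℕ → Set
Fits f l c = ∀ {r} → r < l → suc r ≤ #≤ (f r) c

dominated⇒fits : ∀ j (f : ℕ → ℕ) l s → Dominated j (applyUpTo f l) s → ∀ {r} → r < l → suc (j + r) ≤ #≤ (f r) s
dominated⇒fits j f (suc l) s (p , d) {zero}  _         = subst (λ t → suc t ≤ #≤ (f 0) s) (sym (+-identityʳ j)) p
dominated⇒fits j f (suc l) s (p , d) {suc r} (s≤s r<l) =
  subst (λ t → suc t ≤ #≤ (f (suc r)) s) (sym (+-suc j r)) (dominated⇒fits (suc j) (λ x → f (suc x)) l s d r<l)

fits⇒dominated : ∀ j (f : ℕ → ℕ) l s → (∀ {r} → r < l → suc (j + r) ≤ #≤ (f r) s) → Dominated j (applyUpTo f l) s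
fits⇒dominated j f zero    s h = tt
fits⇒dominated j f (suc l) s h =
  subst (λ t → suc t ≤ #≤ (f 0) s) (+-identityʳ j) (h (s≤s z≤n)) ,
  fits⇒dominated (suc j) (λ x → f (suc x)) l s (λ {r} r<l → subst (λ t → suc t ≤ #≤ (f (suc r)) s) (+-suc j r) (h (s≤s r<l)))

applyUpTo-sorted : ∀ (f : ℕ → ℕ) l → (∀ r → f r ≤ f (suc r)) → Linked _≤_ (applyUpTo f l)
applyUpTo-sorted f zero          h = []
applyUpTo-sorted f (suc zero)    h = [-]
applyUpTo-sorted f (suc (suc l)) h = h 0 ∷ applyUpTo-sorted (λ x → f (suc x)) (suc l) (λ r → h (suc r))

module _ (f : ℕ → ℕ) (f-mono : ∀ r → f r ≤ f (suc r)) (l : ℕ) where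

  sorted≤⇒fits : ∀ c → Pointwise _≤_ (sort c) (applyUpTo f l) → Fits f l c
  sorted≤⇒fits c pw = dominated⇒fits 0 f l c
    (dominated-cong 0 (applyUpTo f l) (λ x → #≤-↭ x (sort-↭ c)) (pointwise⇒dominated (applyUpTo-sorted f l f-mono) pw))

  fits⇒sorted≤ : ∀ c → length c ≡ l → Fits f l c → Pointwise _≤_ (sort c) (applyUpTo f l)
  fits⇒sorted≤ c lc h = dominated⇒pointwise (sort c) (applyUpTo f l) (sort-↗ c) (applyUpTo-sorted f l f-mono)
    (trans (↭-length (sort-↭ c)) (trans lc (sym (length-applyUpTo f l))))
    (dominated-cong 0 (applyUpTo f l) (λ x → sym (#≤-↭ x (sort-↭ c))) (fits⇒dominated 0 f l c h))

-- The complement of the block (i+1, …, i+m): its r-th element is gap i m r.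
gap : ℕ → ℕ → ℕ → ℕ
gap i m r with r <? i
... | yes _ = suc r
... | no _  = suc (m + r)

gap-< : ∀ i m r → r < i → gap i m r ≡ suc r
gap-< i m r p with r <? i
... | yes _ = refl
... | no q  = ⊥-elim (q p)

gap-≥ : ∀ i m r → ¬ r < i → gap i m r ≡ suc (m + r)
gap-≥ i m r p with r <? i
... | yes q = ⊥-elim (p q)
... | no _  = refl

gap-mono : ∀ i m r → gap i m r ≤ gap i m (suc r)
gap-mono i m r with r <? i | suc r <? i
... | yes _ | yes _ = n≤1+n _
... | yes _ | no _  = s≤s (≤-trans (n≤1+n r) (m≤n+m (suc r) m))
... | no p  | yes q = ⊥-elim (p (<-trans (n<1+n r) q))
... | no _  | no _  = s≤s (+-monoʳ-≤ m (n≤1+n r))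

applyUpTo-++ : ∀ (f : ℕ → ℕ) p q → applyUpTo f (p + q) ≡ applyUpTo f p ++ applyUpTo (λ j → f (p + j)) q
applyUpTo-++ f zero    q = refl
applyUpTo-++ f (suc p) q = cong (f 0 ∷_) (applyUpTo-++ (λ j → f (suc j)) p q)

applyUpTo-cong : ∀ l {f g : ℕ → ℕ} → (∀ r → r < l → f r ≡ g r) → applyUpTo f l ≡ applyUpTo g l
applyUpTo-cong zero    h = refl
applyUpTo-cong (suc l) h = cong₂ _∷_ (h 0 (s≤s z≤n)) (applyUpTo-cong l (λ r r<l → h (suc r) (s≤s r<l)))

module _ (n i m : ℕ) (i≤N : i ≤ n ∸ m) (m≤n : m ≤ n) where
  private
    N = n ∸ m
    notInBlock? = λ x → ¬? (x ∈? block i m)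

    inBlock⇒ : ∀ {x} → x ∈ block i m → i < x × x ≤ i + m
    inBlock⇒ mem with ∈-applyUpTo⁻ (λ j → i + suc j) mem
    ... | j , j<m , refl = ≤-trans (s≤s (m≤m+n i j)) (≤-reflexive (sym (+-suc i j))) , +-monoʳ-≤ i j<m

    front  = applyUpTo suc i
    middle = applyUpTo (λ j → suc (i + j)) m
    back   = applyUpTo (λ j → suc (i + (m + j))) (N ∸ i)

    n-pieces : i + (m + (N ∸ i)) ≡ n
    n-pieces = trans (+-comm i _) (trans (+-assoc m (N ∸ i) i) (trans (cong (m +_) (m∸n+n≡m i≤N)) (m+[n∸m]≡n m≤n)))

    [n]-pieces : [ n ] ≡ front ++ (middle ++ back)
    [n]-pieces = begin
      applyUpTo suc n                                     ≡⟨ cong (applyUpTo suc) (sym n-pieces) ⟩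
      applyUpTo suc (i + (m + (N ∸ i)))                   ≡⟨ applyUpTo-++ suc i (m + (N ∸ i)) ⟩
      front ++ applyUpTo (λ j → suc (i + j)) (m + (N ∸ i)) ≡⟨ cong (front ++_) (applyUpTo-++ (λ j → suc (i + j)) m (N ∸ i)) ⟩
      front ++ (middle ++ back)                           ∎

    keep-front : filter notInBlock? front ≡ front
    keep-front = filter-all notInBlock? (applyUpTo⁺₁ suc i (λ {r} r<i mem → <⇒≱ (proj₁ (inBlock⇒ mem)) r<i))

    drop-middle : filter notInBlock? middle ≡ []
    drop-middle = filter-none notInBlock? (applyUpTo⁺₁ _ m (λ {r} r<m ¬mem → ¬mem
      (subst (_∈ block i m) (+-suc i r) (∈-applyUpTo⁺ (λ j → i + suc j) r<m))))

    keep-back : filter notInBlock? back ≡ back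
    keep-back = filter-all notInBlock? (applyUpTo⁺₁ _ (N ∸ i) (λ {r} _ mem →
      <⇒≱ (s≤s (+-monoʳ-≤ i (m≤m+n m r))) (proj₂ (inBlock⇒ mem))))

    gaps-pieces : applyUpTo (gap i m) N ≡ front ++ back
    gaps-pieces = begin
      applyUpTo (gap i m) N                                      ≡⟨ cong (applyUpTo (gap i m)) (sym (m+[n∸m]≡n i≤N)) ⟩
      applyUpTo (gap i m) (i + (N ∸ i))                          ≡⟨ applyUpTo-++ (gap i m) i (N ∸ i) ⟩
      applyUpTo (gap i m) i ++ applyUpTo (λ j → gap i m (i + j)) (N ∸ i)
        ≡⟨ cong₂ _++_ (applyUpTo-cong i (λ r r<i → gap-< i m r r<i)) (applyUpTo-cong (N ∸ i) (λ r _ → gap-back r)) ⟩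
      front ++ back                                              ∎
      where
      gap-back : ∀ r → gap i m (i + r) ≡ suc (i + (m + r))
      gap-back r = trans (gap-≥ i m (i + r) (λ lt → 1+n≰n (≤-trans lt (m≤m+n i r))))
                         (cong suc (trans (sym (+-assoc m i r)) (trans (cong (_+ r) (+-comm m i)) (+-assoc i m r))))

  complement-block : complement n (block i m) ≡ applyUpTo (gap i m) N
  complement-block = begin
    filter notInBlock? [ n ]                  ≡⟨ cong (filter notInBlock?) [n]-pieces ⟩
    filter notInBlock? (front ++ (middle ++ back))
      ≡⟨ trans (filter-++ notInBlock? front _) (cong (filter notInBlock? front ++_) (filter-++ notInBlock? middle back)) ⟩
    filter notInBlock? front ++ (filter notInBlock? middle ++ filter notInBlock? back)
      ≡⟨ cong₂ (λ x y → x ++ y) keep-front (cong₂ _++_ drop-middle keep-back) ⟩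
    front ++ back                             ≡⟨ sym gaps-pieces ⟩
    applyUpTo (gap i m) N                     ∎

module Breakpoints (n i m : ℕ) (1≤m : 1 ≤ m) (1≤i : 1 ≤ i) (i≤N : i ≤ n ∸ m) where
  N = n ∸ m

  m≤n : m ≤ n
  m≤n = <⇒≤ (m∸n≢0⇒n<m (λ e → 1+n≰n (≤-trans 1≤i (subst (i ≤_) e i≤N))))

  -- The tail condition: above k+1 the remaining N-k entries park in the spots after the block.
  Tail : ℕ → List ℕ → Set
  Tail k c = ∀ {j} → j < N ∸ k → suc (j + k) ≤ #≤ (k + suc (m + j)) c

  IsBreakpoint : ℕ → List ℕ → Set
  IsBreakpoint k c = #≤ k c ≡ k × Parks 1 k c × #≤ (suc k) c ≡ k × Tail k c

  SplitBreakpoint : ℕ → List ℕ → Set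
  SplitBreakpoint k c = (length (below k c) ≡ k × Parks 1 k (below k c))
                      × ((length (below 1 (above k c)) ≡ 0 × ⊤) × Parks m (N ∸ k) (above 1 (above k c)))

  breakpointWeight : ℕ → List ℕ → ℕ
  breakpointWeight k = splitWeight k k (parksWeight 1 k) (splitWeight 1 0 (λ _ → 1) (parksWeight m (N ∸ k)))

  private
    above-above : ∀ k c j → #≤ 1 (above k c) ≡ 0 → #≤ k c ≡ k →
      #≤ (m + j) (above 1 (above k c)) + k ≡ #≤ (k + suc (m + j)) c
    above-above k c j none-at-k+1 k-below = begin
      #≤ (m + j) (above 1 (above k c)) + k
        ≡⟨ cong (_+ k) (sym (trans (cong (#≤ (m + j) (above 1 (above k c)) +_) none-at-k+1) (+-identityʳ _))) ⟩
      #≤ (m + j) (above 1 (above k c)) + #≤ 1 (above k c) + k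
        ≡⟨ cong₂ _+_ (#≤-above (m + j) 1 (above k c)) (sym k-below) ⟩
      #≤ (suc (m + j)) (above k c) + #≤ k c
        ≡⟨ #≤-above (suc (m + j)) k c ⟩
      #≤ (k + suc (m + j)) c ∎

    above-one : ∀ k c → #≤ 1 (above k c) + #≤ k c ≡ #≤ (suc k) c
    above-one k c = trans (#≤-above 1 k c) (cong (λ t → #≤ t c) (+-comm k 1))

  split⇒breakpoint : ∀ k c → SplitBreakpoint k c → IsBreakpoint k c
  split⇒breakpoint k c ((len-below , parks) , ((len-one , _) , tail)) = k-below , parks-below , k+1-below , tail-c
    where
    k-below : #≤ k c ≡ k
    k-below = trans (sym (length-below k c)) len-below
    none-at-k+1 : #≤ 1 (above k c) ≡ 0
    none-at-k+1 = trans (sym (length-below 1 (above k c))) len-one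
    parks-below : Parks 1 k c
    parks-below {j} j<k = subst (suc j ≤_) (#≤-below (suc j) k c j<k) (parks j<k)
    k+1-below : #≤ (suc k) c ≡ k
    k+1-below = trans (sym (above-one k c)) (trans (cong (_+ #≤ k c) none-at-k+1) k-below)
    tail-c : Tail k c
    tail-c {j} j< = subst (suc j + k ≤_) (above-above k c j none-at-k+1 k-below) (+-monoˡ-≤ k (tail j<))

  breakpoint⇒split : ∀ k c → IsBreakpoint k c → SplitBreakpoint k c
  breakpoint⇒split k c (k-below , parks , k+1-below , tail) =
    (trans (length-below k c) k-below , parks-below) , ((trans (length-below 1 (above k c)) none-at-k+1 , tt) , tail-above)
    where
    none-at-k+1 : #≤ 1 (above k c) ≡ 0
    none-at-k+1 = +-cancelʳ-≡ (#≤ k c) _ 0 (trans (above-one k c) (trans k+1-below (sym k-below)))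
    parks-below : Parks 1 k (below k c)
    parks-below {j} j<k = subst (suc j ≤_) (sym (#≤-below (suc j) k c j<k)) (parks j<k)
    tail-above : Parks m (N ∸ k) (above 1 (above k c))
    tail-above {j} j< = +-cancelʳ-≤ k (suc j) _ (subst (suc j + k ≤_) (sym (above-above k c j none-at-k+1 k-below)) (tail j<))

  breakpointWeight-reflects : ∀ k c → breakpointWeight k c reflects IsBreakpoint k c
  breakpointWeight-reflects k c = reflects-⇔ (split⇒breakpoint k c) (breakpoint⇒split k c)
    (*-reflects (*-reflects (𝟙-reflects (length (below k c) ≟ k)) (𝟙-reflects (parks? 1 k (below k c))))
                (*-reflects (*-reflects (𝟙-reflects (length (below 1 (above k c)) ≟ 0)) 1-reflects-⊤)
                            (𝟙-reflects (parks? m (N ∸ k) (above 1 (above k c))))))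

  breakpoint⇒fits : ∀ k c → IsBreakpoint k c → i ≤ k → k ≤ N → Fits (gap i m) N c
  breakpoint⇒fits k c (_ , parks , _ , tail) i≤k k≤N {r} r<N with r <? i
  ... | yes r<i = parks (≤-trans r<i i≤k)
  ... | no r≮i with r <? k
  ...   | yes r<k = ≤-trans (parks r<k) (#≤-mono c (s≤s (m≤n+m r m)))
  ...   | no r≮k = subst₂ (λ a t → suc a ≤ #≤ t c) j+k≡r spots (tail (∸-monoˡ-< r<N k≤r))
    where
    k≤r = ≮⇒≥ r≮k
    j+k≡r : r ∸ k + k ≡ r
    j+k≡r = m∸n+n≡m k≤r
    spots : k + suc (m + (r ∸ k)) ≡ suc (m + r)
    spots = trans (solve 3 (λ k m j → k :+ (con 1 :+ (m :+ j)) := con 1 :+ (m :+ (j :+ k))) refl k m (r ∸ k))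
                  (cong (λ t → suc (m + t)) j+k≡r)

  -- A sequence has at most one breakpoint: a smaller one k < k' would force k+1 ≤ #≤ (k+1) c = k.
  breakpoint-unique : ∀ k k' c → IsBreakpoint k c → IsBreakpoint k' c → k ≡ k'
  breakpoint-unique k k' c (_ , parks , k+1-below , _) (_ , parks' , k'+1-below , _) with <-cmp k k'
  ... | tri< k<k' _ _ = ⊥-elim (1+n≰n (subst (suc k ≤_) k+1-below (parks' k<k')))
  ... | tri≈ _ e _    = e
  ... | tri> _ _ k'<k = ⊥-elim (1+n≰n (subst (suc k' ≤_) k'+1-below (parks k'<k)))

  -- Every completion has a breakpoint in [i, N]: the least p ≥ i with #≤ (p+1) c ≤ p.
  -- The search runs upward from p = i, with fuel f = N - p.
  private
    search : ∀ c → length c ≡ N → Fits (gap i m) N c → ∀ f p → f + p ≡ N → i ≤ p → Parks 1 p c →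
      ∃ λ k → i ≤ k × k ≤ N × IsBreakpoint k c
    search c lc fits f p f+p≡N i≤p parks with #≤ (suc p) c ≤? p
    ... | yes stop = p , i≤p , p≤N , (p-below , parks , p+1-below , tail)
      where
      p≤N : p ≤ N
      p≤N = subst (p ≤_) f+p≡N (m≤n+m p f)
      p≤#p : p ≤ #≤ p c
      p≤#p = subst (λ t → t ≤ #≤ t c) pred-p (parks (≤-reflexive pred-p))
        where pred-p : suc (p ∸ 1) ≡ p
              pred-p = m+[n∸m]≡n (≤-trans 1≤i i≤p)
      p-below : #≤ p c ≡ p
      p-below = ≤-antisym (≤-trans (#≤-mono c (n≤1+n p)) stop) p≤#p
      p+1-below : #≤ (suc p) c ≡ p
      p+1-below = ≤-antisym stop (≤-trans p≤#p (#≤-mono c (n≤1+n p)))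
      tail : Tail p c
      tail {j} j< = subst (λ t → suc (j + p) ≤ #≤ t c)
        (trans (gap-≥ i m (j + p) (λ lt → 1+n≰n (≤-trans lt (≤-trans i≤p (m≤n+m p j)))))
               (solve 3 (λ p m j → con 1 :+ (m :+ (j :+ p)) := p :+ (con 1 :+ (m :+ j))) refl p m j))
        (fits (subst (_< N) (+-comm p j) (<∸⇒+< p j N j<)))
    ... | no go with f
    ...   | zero = ⊥-elim (1+n≰n (≤-trans (≰⇒> go) (subst (#≤ (suc p) c ≤_) (trans lc (sym f+p≡N)) (#≤-length (suc p) c))))
    ...   | suc f' = search c lc fits f' (suc p) (trans (+-suc f' p) f+p≡N) (≤-trans i≤p (n≤1+n p)) parks-p+1
      where
      parks-p+1 : Parks 1 (suc p) c
      parks-p+1 (s≤s j≤p) with m≤n⇒m<n∨m≡n j≤p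
      ... | inj₁ j<p = parks j<p
      ... | inj₂ refl = ≰⇒> go

  breakpoint-exists : ∀ c → length c ≡ N → Fits (gap i m) N c → ∃ λ k → i ≤ k × k ≤ N × IsBreakpoint k c
  breakpoint-exists c lc fits = search c lc fits (N ∸ i) i (m∸n+n≡m i≤N) ≤-refl
    (λ {j} j<i → subst (λ t → suc j ≤ #≤ t c) (gap-< i m j j<i) (fits (≤-trans j<i i≤N)))

  breakpointWeight-1 : ∀ k c → IsBreakpoint k c → breakpointWeight k c ≡ 1
  breakpointWeight-1 k c bp with breakpointWeight-reflects k c
  ... | inj₁ (e , _)   = e
  ... | inj₂ (_ , ¬bp) = ⊥-elim (¬bp bp)

  breakpointWeight-0 : ∀ k c → ¬ IsBreakpoint k c → breakpointWeight k c ≡ 0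
  breakpointWeight-0 k c ¬bp with breakpointWeight-reflects k c
  ... | inj₁ (_ , bp) = ⊥-elim (¬bp bp)
  ... | inj₂ (e , _)  = e

  completion⇒fits : ∀ c → IsParkingCompletion n (block i m) c → Fits (gap i m) N c
  completion⇒fits c pc = sorted≤⇒fits (gap i m) (gap-mono i m) N c
    (subst (Pointwise _≤_ (sort c)) (complement-block n i m i≤N m≤n) pc)

  fits⇒completion : ∀ c → length c ≡ N → Fits (gap i m) N c → IsParkingCompletion n (block i m) c
  fits⇒completion c lc fits = subst (Pointwise _≤_ (sort c)) (sym (complement-block n i m i≤N m≤n))
    (fits⇒sorted≤ (gap i m) (gap-mono i m) N c lc fits)

  completion-by-breakpoint : ∀ c → length c ≡ N →
    𝟙 (isParkingCompletion? n (block i m) c) ≡ sumBelow (suc N ∸ i) (λ j → breakpointWeight (i + j) c)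
  completion-by-breakpoint c lc with isParkingCompletion? n (block i m) c
  ... | yes pc with breakpoint-exists c lc (completion⇒fits c pc)
  ...   | k , i≤k , k≤N , bp = sym (begin
    sumBelow (suc N ∸ i) (λ j → breakpointWeight (i + j) c)
      ≡⟨ sumBelow-single (suc N ∸ i) _ (k ∸ i) (∸-monoˡ-< (s≤s k≤N) i≤k) others ⟩
    breakpointWeight (i + (k ∸ i)) c
      ≡⟨ cong (λ t → breakpointWeight t c) (m+[n∸m]≡n i≤k) ⟩
    breakpointWeight k c
      ≡⟨ breakpointWeight-1 k c bp ⟩
    1 ∎)
    where
    others : ∀ j → j < suc N ∸ i → j ≢ k ∸ i → breakpointWeight (i + j) c ≡ 0
    others j _ j≢k-i = breakpointWeight-0 (i + j) c (λ bp' →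
      j≢k-i (trans (sym (m+n∸m≡n i j)) (cong (_∸ i) (breakpoint-unique (i + j) k c bp' bp))))
  completion-by-breakpoint c lc | no ¬pc = sym (sumBelow-zero (suc N ∸ i) _ (λ j j< →
    breakpointWeight-0 (i + j) c (λ bp → ¬pc (fits⇒completion c lc
      (breakpoint⇒fits (i + j) c bp (m≤m+n i j) (s≤s⁻¹ (<∸⇒+< i j (suc N) j<)))))))

  private
    n-k : ∀ k → k ≤ N → n ∸ k ≡ m + (N ∸ k)
    n-k k k≤N = trans (cong (_∸ k) (sym (m+[n∸m]≡n m≤n))) (+-∸-assoc m k≤N)

    mFactor≡pfCount : ∀ k → k ≤ N → mFactor m n k ≡ pfCount (N ∸ k) m
    mFactor≡pfCount k k≤N with suc (k + m) ≤? n
    ... | yes k+m<n = trans (cong₂ (λ a b → m * a ^ b) (n-k k k≤N) (cong (_∸ 1) (trans (cong (_∸ m) (n-k k k≤N)) (m+n∸m≡n m (N ∸ k)))))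
                            (pfCount-form (N ∸ k) (m<n⇒0<n∸m k<N))
      where
      k<N : k < N
      k<N = subst (_≤ N) (m+n∸n≡m (suc k) m) (∸-monoˡ-≤ m k+m<n)
      pfCount-form : ∀ X → 1 ≤ X → m * (m + X) ^ (X ∸ 1) ≡ pfCount X m
      pfCount-form (suc X) _ = refl
    ... | no k+m≮n = cong (λ t → pfCount t m) (sym (trans (cong (N ∸_) k≡N) (n∸n≡0 N)))
      where
      k≡N : k ≡ N
      k≡N with m≤n⇒m<n∨m≡n k≤N
      ... | inj₂ e = e
      ... | inj₁ k<N = ⊥-elim (k+m≮n (subst (suc k + m ≤_) (m∸n+n≡m m≤n) (+-monoˡ-≤ m k<N)))

    pfCount-one : ∀ k → 1 ≤ k → pfCount k 1 ≡ suc k ^ (k ∸ 1)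
    pfCount-one (suc k) _ = +-identityʳ _

    count-tail : ∀ k → k ≤ N → sumSeqs (n ∸ k) (N ∸ k) (splitWeight 1 0 (λ _ → 1) (parksWeight m (N ∸ k))) ≡ pfCount (N ∸ k) m
    count-tail k k≤N = begin
      sumSeqs (n ∸ k) (N ∸ k) tailWeight          ≡⟨ cong (λ t → sumSeqs t (N ∸ k) tailWeight) n-k≡1+D ⟩
      sumSeqs (1 + D) (N ∸ k) tailWeight          ≡⟨ sumSeqs-split 1 D (N ∸ k) 0 (λ _ → 1) (parksWeight m (N ∸ k)) ⟩
      sumSeqs D (N ∸ k) (parksWeight m (N ∸ k)) + 0 ≡⟨ +-identityʳ _ ⟩
      sumSeqs D (N ∸ k) (parksWeight m (N ∸ k))   ≡⟨ count-parks D (N ∸ k) m (trans (sym (n-k k k≤N)) n-k≡1+D) ⟩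
      pfCount (N ∸ k) m                           ∎
      where
      tailWeight = splitWeight 1 0 (λ _ → 1) (parksWeight m (N ∸ k))
      D = n ∸ k ∸ 1
      n-k≡1+D : n ∸ k ≡ 1 + D
      n-k≡1+D = sym (m+[n∸m]≡n (subst (1 ≤_) (sym (n-k k k≤N)) (≤-trans 1≤m (m≤m+n m _))))

  -- The number of c ∈ [n]^N with breakpoint k is the k-th summand of the theorem:
  -- choose the k small positions, a parking function of length k, and a tail.
  count-breakpoint : ∀ k → i ≤ k → k ≤ N → sumSeqs n N (breakpointWeight k) ≡ term m n k
  count-breakpoint k i≤k k≤N = begin
    sumSeqs n N (breakpointWeight k)
      ≡⟨ cong (λ t → sumSeqs t N (breakpointWeight k)) (sym (m+[n∸m]≡n k≤n)) ⟩
    sumSeqs (k + (n ∸ k)) N (breakpointWeight k)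
      ≡⟨ sumSeqs-split k (n ∸ k) N k (parksWeight 1 k) _ ⟩
    binom N k * sumSeqs k k (parksWeight 1 k) * sumSeqs (n ∸ k) (N ∸ k) (splitWeight 1 0 (λ _ → 1) (parksWeight m (N ∸ k)))
      ≡⟨ cong₂ (λ x y → binom N k * x * y) (count-parks k k 1 refl) (count-tail k k≤N) ⟩
    binom N k * pfCount k 1 * pfCount (N ∸ k) m
      ≡⟨ cong₂ (λ x y → x * y) (cong₂ _*_ (binom≡C N k) (pfCount-one k (≤-trans 1≤i i≤k))) (sym (mFactor≡pfCount k k≤N)) ⟩
    term m n k ∎
    where
    k≤n : k ≤ n
    k≤n = ≤-trans k≤N (m∸n≤m n m)

-- Count the completions as a sum of indicators over [n]^(n-m), split each
-- indicator by the breakpoint k ∈ [i, n-m], and count each breakpoint class.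
corollary1p2 : (m n i : ℕ) → 1 ≤ m → 1 ≤ n → 1 ≤ i → i ≤ n ∸ m →
    #PC n (block i m) ≡ sumFromTo i (n ∸ m) (term m n)
corollary1p2 m n i 1≤m _ 1≤i i≤N = begin
  length (filter (isParkingCompletion? n (block i m)) (seqs n (n ∸ length (block i m))))
    ≡⟨ cong (λ L → length (filter (isParkingCompletion? n (block i m)) (seqs n (n ∸ L)))) (length-applyUpTo _ m) ⟩
  length (filter (isParkingCompletion? n (block i m)) (seqs n N))
    ≡⟨ count-filter n N (isParkingCompletion? n (block i m)) ⟩
  sumSeqs n N (λ c → 𝟙 (isParkingCompletion? n (block i m) c))
    ≡⟨ sumSeqs-cong n N (λ c lc _ → completion-by-breakpoint c lc) ⟩
  sumSeqs n N (λ c → sumBelow (suc N ∸ i) (λ j → breakpointWeight (i + j) c))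
    ≡⟨ sumSeqs-sumBelow n N (suc N ∸ i) (λ j → breakpointWeight (i + j)) ⟩
  sumBelow (suc N ∸ i) (λ j → sumSeqs n N (breakpointWeight (i + j)))
    ≡⟨ sumBelow-cong (suc N ∸ i) (λ j j< → count-breakpoint (i + j) (m≤m+n i j) (s≤s⁻¹ (<∸⇒+< i j (suc N) j<))) ⟩
  sumBelow (suc N ∸ i) (λ j → term m n (i + j))
    ≡⟨ sym (sum-applyUpTo (λ j → term m n (i + j)) (suc N ∸ i)) ⟩
  sumFromTo i N (term m n) ∎
  where open Breakpoints n i m 1≤m 1≤i i≤N
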